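{- Let $\mathcal H$ be a finite graph and $\Delta$ a positive integer. The following are equivalent: (1) $\mathcal H$ admits a proper vertex coloring with $\Delta$ colors; (2) for every $r$, there exists a $0$-round GLOCAL algorithm that $\Delta$-colors $\mathrm{Hom}(T^r_\Delta,\mathcal H)$; (3) there exist $r$ and an $r$-round GLOCAL algorithm that $\Delta$-colors $\mathrm{Hom}(T^{r+1}_\Delta,\mathcal H)$.
   Context: Let $T_\Delta$ be the infinite $\Delta$-regular tree and $T^r_\Delta$ the ball of radius $r$ around a vertex of $T_\Delta$. $\mathrm{Hom}(T^r_\Delta,\mathcal H)$ is the collection of labeled trees obtained by labeling the vertices of $T^r_\Delta$ with vertices of $\mathcal H$ such that the labeling is a graph homomorphism $T^r_\Delta\to\mathcal H$. An $r$-round GLOCAL algorithm (on trees with degrees $\le\Delta$) is a partial function from isomorphism classes of labeled rooted trees of maximum degree $\le\Delta$ and radius $\le r$ (from the root) to a set $\Sigma$; running it on a labeled tree $G$ assigns to each vertex $v$ its value on the labeled ball $B_G(v,r)$ rooted at $v$. It $\Delta$-colors a collection $\mathcal F$ of labeled trees if for every $G\in\mathcal F$ running it on $G$ assigns every vertex one of $\Delta$ colors and the result is a proper vertex coloring of $G$. -}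

module Defs where

open import Data.Nat using (ℕ; zero; suc; _≤_; _<_)
open import Data.Fin using (Fin; _≟_)
open import Data.Bool using (Bool; true; false; if_then_else_)
open import Data.List using (List; []; _∷_; length; map; allFin; filter)
open import Data.List.Relation.Binary.Permutation.Homogeneous using (Permutation)
open import Data.Maybe using (Maybe; just; nothing)
open import Data.Product using (Σ; ∃; ∃-syntax; _×_; _,_)
open import Relation.Binary.PropositionalEquality using (_≡_; _≢_; refl)
open import Data.Unit using (⊤)
open import Relation.Nullary using (¬_; Dec; yes; no)
open import Relation.Nullary.Decidable using (⌊_⌋)

record Graph : Set where
  field
    n     : ℕ
    adj   : Fin n → Fin n → Bool
    sym   : ∀ x y → adj x y ≡ adj y x
    irrefl : ∀ x → adj x x ≡ false

open Graph public

ProperlyColorable : Graph → ℕ → Set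
ProperlyColorable H Δ =
  Σ (Fin (n H) → Fin Δ) λ c → ∀ x y → adj H x y ≡ true → c x ≢ c y

-- Labeled rooted trees (children unordered up to isomorphism)

data RTree (L : Set) : Set where
  node : L → List (RTree L) → RTree L

data _≅_ {L : Set} : RTree L → RTree L → Set where
  node : ∀ {a b ts us} → a ≡ b → Permutation _≅_ ts us → node a ts ≅ node b us

-- The Δ-regular tree T_Δ: vertices are reduced words over Fin Δ
-- (stored last letter first); w is adjacent to step w a for each a.

Word : ℕ → Set
Word Δ = List (Fin Δ)

Reduced : ∀ {Δ} → Word Δ → Set
Reduced []           = ⊤
Reduced (a ∷ [])     = ⊤
Reduced (a ∷ b ∷ w)  = a ≢ b × Reduced (b ∷ w)

step : ∀ {Δ} → Word Δ → Fin Δ → Word Δ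
step []      b = b ∷ []
step (a ∷ w) b = if ⌊ a ≟ b ⌋ then w else (b ∷ a ∷ w)

VertexOf : ∀ {Δ} → ℕ → Word Δ → Set
VertexOf R w = Reduced w × length w ≤ R

-- Labeled trees in Hom(T^R_Δ, H): a labeling of the vertices of T^R_Δ
-- by vertices of H which is a graph homomorphism.  (Values outside the
-- ball are irrelevant and never inspected.)

IsHom : (H : Graph) (Δ R : ℕ) → (Word Δ → Fin (n H)) → Set
IsHom H Δ R ℓ = ∀ w a → VertexOf R w → VertexOf R (step w a) →
  adj H (ℓ w) (ℓ (step w a)) ≡ true

notFrom : ∀ {Δ} (from : Maybe (Fin Δ)) (a : Fin Δ) → Dec (from ≢ just a)
notFrom nothing a = yes (λ ())
notFrom (just b) a with b ≟ a
... | yes refl = no (λ f → f refl)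
... | no b≢a = yes (λ { refl → b≢a refl })

-- the labeled ball B_G(v, r) of G = (T^R_Δ, ℓ), rooted at v.
-- `from` is the letter of the edge we arrived by (not to be revisited).
ball : ∀ {Δ L} (R : ℕ) (ℓ : Word Δ → L) (r : ℕ) (v : Word Δ)
       (from : Maybe (Fin Δ)) → RTree L
ball {Δ} R ℓ zero v from = node (ℓ v) []
ball {Δ} R ℓ (suc r) v from =
  node (ℓ v) (map (λ a → ball R ℓ r (step v a) (just a)) (filter ok (allFin Δ)))
  where
  open import Data.Nat using (_≤?_)
  open import Relation.Nullary using (_×-dec_; ¬?)
  ok : (a : Fin Δ) → Dec (from ≢ just a × length (step v a) ≤ R)
  ok a = notFrom from a ×-dec (length (step v a) ≤? R)

-- GLOCAL algorithms.  A (partial) GLOCAL algorithm with output colours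
-- Fin Δ is a map from labeled rooted trees to Maybe (Fin Δ) (nothing =
-- undefined) which is constant on isomorphism classes.

IsoInvariant : ∀ {L Δ} → (RTree L → Maybe (Fin Δ)) → Set
IsoInvariant A = ∀ t u → t ≅ u → A t ≡ A u

DeltaColorsHom : (H : Graph) (Δ r R : ℕ) → (RTree (Fin (n H)) → Maybe (Fin Δ)) → Set
DeltaColorsHom H Δ r R A =
  ∀ (ℓ : Word Δ → Fin (n H)) → IsHom H Δ R ℓ →
    Σ (∀ v → VertexOf R v → Fin Δ) λ col →
      (∀ v (p : VertexOf R v) → A (ball R ℓ r v nothing) ≡ just (col v p))
      × (∀ v a (p : VertexOf R v) (q : VertexOf R (step v a)) → col v p ≢ col (step v a) q)

GlocalColorable : (H : Graph) (Δ r R : ℕ) → Set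
GlocalColorable H Δ r R =
  Σ (RTree (Fin (n H)) → Maybe (Fin Δ)) λ A → IsoInvariant A × DeltaColorsHom H Δ r R A

-- (1) ⇒ (2) colours every vertex by the colour of its label, and (2) ⇒ (3) is immediate.
-- (3) ⇒ (1) is a determinacy argument.  Fix an r-round algorithm A for Hom(T^(r+1), H).
-- For a vertex x of H and a colour i, Bob picks a neighbour y of x, and then Alice and Bob
-- alternately extend, one depth per round, homomorphic labellings α of T_Δ rooted at x and
-- β rooted at y.  Alice wins if A colours the root i in the tree obtained from α by
-- replacing its i-th branch with β.  The game is finite, hence determined.
--   * If Alice wins (x, i) and (y, i) for adjacent x, y, playing her two strategies against
--     each other gives one labelled tree in which A colours both the root and its i-th
--     neighbour i, since the picture seen from that neighbour is the swapped graft.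
--   * If Bob wins (x, i) for every i, his Δ strategies can be played simultaneously against
--     a single tree assembled from his own answers; A must colour its root somehow.
-- So every x has a colour Alice wins, and any such choice is a proper Δ-colouring of H.
{-# OPTIONS --safe #-}
module Submission where

open import Defs hiding (sym)
open import Level using (0ℓ)
open import Data.Nat using (ℕ; zero; suc; _+_; _≤_; z≤n; s≤s; _≤?_) renaming (_≟_ to _≟ℕ_)
open import Data.Nat.Properties using (≤-refl; ≤-trans; <⇒≤; ≤-pred; ≤∧≢⇒<; 1+n≰n; n≤1+n; m≤m+n; +-suc; +-comm; +-monoˡ-≤; suc-injective)
open import Data.Bool using (true; false; if_then_else_)
import Data.Bool.Properties as Bool
open import Data.Fin using (Fin; _≟_)
open import Data.Fin.Properties using (any?; all?)
open import Data.List using (List; []; _∷_; length; map; filter; allFin; _∷ʳ_; initLast; _∷ʳ′_)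
open import Data.List.Properties using (filter-≐; map-cong; length-++)
open import Data.Vec using (Vec; []; _∷_; lookup; tabulate; head)
open import Data.Vec.Properties using (lookup∘tabulate)
open import Data.Vec.Functional using (updateAt)
open import Data.Vec.Functional.Properties using (updateAt-updates; updateAt-minimal)
open import Data.Maybe using (Maybe; just; nothing)
open import Data.Maybe.Properties using (just-injective; ≡-dec)
open import Data.Product using (Σ; ∃; ∃₂; _×_; _,_; proj₁; proj₂)
open import Data.Empty using (⊥; ⊥-elim)
open import Data.Unit using (tt)
open import Function using (_∘_; id; const)
open import Function.Bundles using (_⇔_; mk⇔)
open import Relation.Nullary using (¬_; Dec; yes; no; ¬?; _×-dec_; _→-dec_)
open import Relation.Nullary.Decidable using (decidable-stable; map′)
open import Relation.Unary using (Pred; Decidable)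
open import Relation.Binary.PropositionalEquality using (_≡_; _≢_; refl; sym; trans; cong; cong₂; subst; subst₂; module ≡-Reasoning)

Searchable : Set → Set₁
Searchable X = ∀ {P : Pred X 0ℓ} → Decidable P → Dec (∃ P)

searchable⇒∀? : ∀ {X} → Searchable X → ∀ {P : Pred X 0ℓ} → Decidable P → Dec (∀ x → P x)
searchable⇒∀? search P? with search (¬? ∘ P?)
... | yes (x , ¬px) = no (λ all → ¬px (all x))
... | no  ∄¬P       = yes (λ x → decidable-stable (P? x) (∄¬P ∘ (x ,_)))

Vec-searchable : ∀ {X} → Searchable X → ∀ m → Searchable (Vec X m)
Vec-searchable search zero    P? = map′ ([] ,_) (λ { ([] , p) → p }) (P? [])
Vec-searchable search (suc m) P? =
  map′ (λ (x , xs , p) → x ∷ xs , p) (λ { (x ∷ xs , p) → x , xs , p })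
       (search λ x → Vec-searchable search m (P? ∘ (x ∷_)))

module FiniteGame {Board : Set} {Move : ℕ → Set} (move : ∀ k → Move k → Board → Board) where

  Payoff : Set₁
  Payoff = Board → Board → Set

  AliceWins : Payoff → List ℕ → Payoff
  AliceWins P []       α β = P α β
  AliceWins P (k ∷ ks) α β = ∃ λ f → ∀ g → AliceWins P ks (move k f α) (move k g β)

  BobWins : Payoff → List ℕ → Payoff
  BobWins P []       α β = P α β
  BobWins P (k ∷ ks) α β = ∀ f → ∃ λ g → BobWins P ks (move k f α) (move k g β)

  module _ (searchable : ∀ k → Searchable (Move k)) {P : Payoff} (P? : ∀ α β → Dec (P α β)) where

    aliceWins? : ∀ ks α β → Dec (AliceWins P ks α β)
    aliceWins? []       = P?
    aliceWins? (k ∷ ks) α β =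
      searchable k λ f → searchable⇒∀? (searchable k) λ g → aliceWins? ks (move k f α) (move k g β)

    determinacy : ∀ ks α β → ¬ AliceWins P ks α β → BobWins (λ α β → ¬ P α β) ks α β
    determinacy []       α β ¬won = ¬won
    determinacy (k ∷ ks) α β ¬won f
      with searchable k (λ g → ¬? (aliceWins? ks (move k f α) (move k g β)))
    ... | yes (g , ¬won′) = g , determinacy ks _ _ ¬won′
    ... | no  ∄g          = ⊥-elim (¬won (f , λ g → decidable-stable (aliceWins? ks _ _) (∄g ∘ (g ,_))))

  alice-vs-alice : (Legal : Payoff) → (∀ k f g {α β} → Legal α β → Legal (move k f α) (move k g β)) →
    ∀ {P Q : Payoff} ks {α β} → Legal α β → AliceWins P ks α β → AliceWins Q ks β α →
    ∃₂ λ α′ β′ → Legal α′ β′ × P α′ β′ × Q β′ α′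
  alice-vs-alice Legal legal []       ok p q = _ , _ , ok , p , q
  alice-vs-alice Legal legal (k ∷ ks) ok (f , p) (g , q) =
    alice-vs-alice Legal legal ks (legal k f g ok) (p g) (q f)

module _ {Δ : ℕ} where

  step-self : ∀ a (w : Word Δ) → step (a ∷ w) a ≡ w
  step-self a w with a ≟ a
  ... | yes _  = refl
  ... | no a≢a = ⊥-elim (a≢a refl)

  step-other : ∀ {a b} (w : Word Δ) → a ≢ b → step (a ∷ w) b ≡ b ∷ a ∷ w
  step-other {a} {b} w a≢b with a ≟ b
  ... | yes a≡b = ⊥-elim (a≢b a≡b)
  ... | no  _   = refl

  length-step : ∀ (v : Word Δ) a → length (step v a) ≤ suc (length v)
  length-step []      a = ≤-refl
  length-step (b ∷ v) a with b ≟ a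
  ... | yes _ = ≤-trans (n≤1+n _) (n≤1+n _)
  ... | no  _ = ≤-refl

  Reduced-tail : ∀ a (v : Word Δ) → Reduced (a ∷ v) → Reduced v
  Reduced-tail a []      _         = tt
  Reduced-tail a (b ∷ v) (_ , red) = red

  Reduced-step : ∀ (v : Word Δ) a → Reduced v → Reduced (step v a)
  Reduced-step []      a _   = tt
  Reduced-step (b ∷ v) a red with b ≟ a
  ... | yes _   = Reduced-tail b v red
  ... | no  b≢a = (b≢a ∘ sym) , red

  Reduced-∷ʳ-∷ʳ : ∀ (w : Word Δ) a b → Reduced (w ∷ʳ a ∷ʳ b) → a ≢ b
  Reduced-∷ʳ-∷ʳ []          a b (a≢b , _) = a≢b
  Reduced-∷ʳ-∷ʳ (_ ∷ [])    a b (_ , red) = Reduced-∷ʳ-∷ʳ [] a b red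
  Reduced-∷ʳ-∷ʳ (_ ∷ c ∷ w) a b (_ , red) = Reduced-∷ʳ-∷ʳ (c ∷ w) a b red

  length-∷ʳ : ∀ (w : Word Δ) a → length (w ∷ʳ a) ≡ suc (length w)
  length-∷ʳ w a = trans (length-++ w) (+-comm (length w) 1)

  -- T_Δ is the Cayley graph of the free product of Δ copies of ℤ/2 (words are stored
  -- last letter first); translate i is left multiplication by the generator i, a
  -- graph automorphism sending the root to i ∷ [].
  translate : Fin Δ → Word Δ → Word Δ
  translate i []          = i ∷ []
  translate i (a ∷ [])    = step (i ∷ []) a
  translate i (a ∷ b ∷ w) = a ∷ translate i (b ∷ w)

  translate-∷ʳ-self : ∀ i (v : Word Δ) → translate i (v ∷ʳ i) ≡ v
  translate-∷ʳ-self i []          = step-self i []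
  translate-∷ʳ-self i (a ∷ [])    = cong (a ∷_) (step-self i [])
  translate-∷ʳ-self i (a ∷ b ∷ v) = cong (a ∷_) (translate-∷ʳ-self i (b ∷ v))

  translate-∷ʳ-other : ∀ {i c} (v : Word Δ) → c ≢ i → translate i (v ∷ʳ c) ≡ v ∷ʳ c ∷ʳ i
  translate-∷ʳ-other []          c≢i = step-other [] (c≢i ∘ sym)
  translate-∷ʳ-other (a ∷ [])    c≢i = cong (a ∷_) (translate-∷ʳ-other [] c≢i)
  translate-∷ʳ-other (a ∷ b ∷ v) c≢i = cong (a ∷_) (translate-∷ʳ-other (b ∷ v) c≢i)

  step-translate : ∀ i (v : Word Δ) a → step (translate i v) a ≡ translate i (step v a)
  step-translate i []          a = refl
  step-translate i (b ∷ [])    a with b ≟ a | i ≟ b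
  ... | yes refl | yes refl = refl
  ... | yes refl | no  i≢b  = step-self b (i ∷ [])
  ... | no  b≢a  | yes refl = cong (a ∷_) (sym (step-self i []))
  ... | no  b≢a  | no  i≢b  = trans (step-other (i ∷ []) b≢a) (cong (a ∷_) (sym (step-other [] i≢b)))
  step-translate i (b ∷ c ∷ w) a with b ≟ a
  ... | yes _ = refl
  ... | no  _ = refl

  ball-transport : ∀ {L : Set} (τ : Word Δ → Word Δ) → (∀ v a → step (τ v) a ≡ τ (step v a)) →
    ∀ {ℓ ℓ′ : Word Δ → L} R k v from → Reduced v → length v + k ≤ R → length (τ v) + k ≤ R →
    (∀ w → Reduced w → length w ≤ length v + k → ℓ (τ w) ≡ ℓ′ w) →
    ball R ℓ k (τ v) from ≡ ball R ℓ′ k v from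
  ball-transport τ step-τ R zero v from red _ _ same =
    cong (λ x → node x []) (same v red (m≤m+n _ 0))
  ball-transport τ step-τ {ℓ} {ℓ′} R (suc k) v from red v-in τv-in same =
    cong₂ node (same v red (m≤m+n _ (suc k))) (begin
      map (λ a → ball R ℓ k (step (τ v) a) (just a)) (filter (inBall (τ v)) (allFin Δ))
        ≡⟨ cong (map _) (filter-≐ (inBall (τ v)) (inBall v)
             ((λ (fresh , _) → fresh , step-in v v-in _) , (λ (fresh , _) → fresh , step-in (τ v) τv-in _))
             (allFin Δ)) ⟩
      map (λ a → ball R ℓ k (step (τ v) a) (just a)) (filter (inBall v) (allFin Δ))
        ≡⟨ map-cong child _ ⟩
      map (λ a → ball R ℓ′ k (step v a) (just a)) (filter (inBall v) (allFin Δ)) ∎)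
    where
    open ≡-Reasoning
    inBall : ∀ u a → Dec (from ≢ just a × length (step u a) ≤ R)
    inBall u a = notFrom from a ×-dec (length (step u a) ≤? R)
    step-length : ∀ u a → length u + suc k ≤ R → length (step u a) + k ≤ R
    step-length u a u-in = ≤-trans (+-monoˡ-≤ k (length-step u a)) (subst (_≤ R) (+-suc (length u) k) u-in)
    step-in : ∀ u → length u + suc k ≤ R → ∀ a → length (step u a) ≤ R
    step-in u u-in a = ≤-trans (m≤m+n _ k) (step-length u a u-in)
    child : ∀ a → ball R ℓ k (step (τ v) a) (just a) ≡ ball R ℓ′ k (step v a) (just a)
    child a = trans (cong (λ u → ball R ℓ k u (just a)) (step-τ v a))
      (ball-transport τ step-τ R k (step v a) (just a) (Reduced-step v a red) (step-length v a v-in)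
        (subst (λ u → length u + k ≤ R) (step-τ v a) (step-length (τ v) a τv-in))
        (λ w red′ w-in → same w red′ (≤-trans w-in (step-length′ v a))))
      where
      step-length′ : ∀ u a → length (step u a) + k ≤ length u + suc k
      step-length′ u a = subst (length (step u a) + k ≤_) (sym (+-suc (length u) k)) (+-monoˡ-≤ k (length-step u a))

module _ {Δ : ℕ} {X : Set} where

  AgreeUpTo : ℕ → (Word Δ → X) → (Word Δ → X) → Set
  AgreeUpTo k ℓ ℓ′ = ∀ w → length w ≤ k → ℓ w ≡ ℓ′ w

  star : X → (Fin Δ → Word Δ → X) → Word Δ → X
  star x t []          = x
  star x t (a ∷ [])    = t a []
  star x t (a ∷ b ∷ w) = star x (λ c v → t c (a ∷ v)) (b ∷ w)

  star-∷ʳ : ∀ x t (v : Word Δ) c → star x t (v ∷ʳ c) ≡ t c v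
  star-∷ʳ x t []          c = refl
  star-∷ʳ x t (a ∷ [])    c = refl
  star-∷ʳ x t (a ∷ b ∷ v) c = star-∷ʳ x (λ c v → t c (a ∷ v)) (b ∷ v) c

  star-agree : ∀ {k x t t′} → (∀ c → AgreeUpTo k (t c) (t′ c)) → AgreeUpTo (suc k) (star x t) (star x t′)
  star-agree {k} {x} {t} {t′} same w w-in with initLast w
  ... | []      = refl
  ... | u ∷ʳ′ c = begin
    star x t (u ∷ʳ c)   ≡⟨ star-∷ʳ x t u c ⟩
    t c u               ≡⟨ same c u (≤-pred (subst (_≤ suc k) (length-∷ʳ u c) w-in)) ⟩
    t′ c u              ≡⟨ star-∷ʳ x t′ u c ⟨
    star x t′ (u ∷ʳ c)  ∎
    where open ≡-Reasoning

  branch : Fin Δ → (Word Δ → X) → Word Δ → X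
  branch c ℓ v = ℓ (v ∷ʳ c)

  graft : Fin Δ → (Word Δ → X) → (Word Δ → X) → Word Δ → X
  graft i α β = star (α []) (updateAt (λ c → branch c α) i (const β))

  graft-branch : ∀ i α β (v : Word Δ) → graft i α β (v ∷ʳ i) ≡ β v
  graft-branch i α β v =
    trans (star-∷ʳ _ _ v i) (cong (λ t → t v) (updateAt-updates i {const β} (λ c → branch c α)))

  graft-other : ∀ {i c} α β (v : Word Δ) → c ≢ i → graft i α β (v ∷ʳ c) ≡ α (v ∷ʳ c)
  graft-other {i} {c} α β v c≢i =
    trans (star-∷ʳ _ _ v c) (cong (λ t → t v) (updateAt-minimal c i {const β} (λ c → branch c α) c≢i))

  graft-translate : ∀ i α β v → Reduced v → graft i α β (translate i v) ≡ graft i β α v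
  graft-translate i α β v red with initLast v
  ... | []      = graft-branch i α β []
  ... | u ∷ʳ′ c with c ≟ i
  ...   | yes refl = begin
    graft i α β (translate i (u ∷ʳ i))  ≡⟨ cong (graft i α β) (translate-∷ʳ-self i u) ⟩
    graft i α β u                       ≡⟨ off-branch u red ⟩
    α u                                 ≡⟨ graft-branch i β α u ⟨
    graft i β α (u ∷ʳ i)                ∎
    where
    open ≡-Reasoning
    off-branch : ∀ u → Reduced (u ∷ʳ i) → graft i α β u ≡ α u
    off-branch u red with initLast u
    ... | []        = refl
    ... | u′ ∷ʳ′ c′ = graft-other α β u′ (Reduced-∷ʳ-∷ʳ u′ c′ i red)
  ...   | no c≢i = begin
    graft i α β (translate i (u ∷ʳ c))  ≡⟨ cong (graft i α β) (translate-∷ʳ-other u c≢i) ⟩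
    graft i α β (u ∷ʳ c ∷ʳ i)           ≡⟨ graft-branch i α β (u ∷ʳ c) ⟩
    β (u ∷ʳ c)                          ≡⟨ graft-other β α u c≢i ⟨
    graft i β α (u ∷ʳ c)                ∎
    where open ≡-Reasoning

  graft-agree : ∀ {k i α β Λ} → AgreeUpTo k α Λ → (∀ v → β v ≡ branch i Λ v) → AgreeUpTo k (graft i α β) Λ
  graft-agree {i = i} {α} {β} same β≡ w w-in with initLast w
  ... | []      = same [] w-in
  ... | u ∷ʳ′ c with c ≟ i
  ...   | yes refl = trans (graft-branch i α β u) (β≡ u)
  ...   | no  c≢i  = trans (graft-other α β u c≢i) (same (u ∷ʳ c) w-in)

-- Moves are finite tables rather than functions on words, so that quantifying over them
-- is decidable without function extensionality.
module _ {d : ℕ} where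

  Table : ℕ → Set → Set
  Table zero    X = X
  Table (suc k) X = Vec (Table k X) (suc d)

  -- Meant for words of length k; shorter words read a junk entry.
  lookupT : ∀ {k X} → Table k X → Word (suc d) → X
  lookupT {zero}  x _       = x
  lookupT {suc k} t []      = lookupT (head t) []
  lookupT {suc k} t (a ∷ w) = lookupT (lookup t a) w

  tabulateT : ∀ {X} k → (Word (suc d) → X) → Table k X
  tabulateT zero    ℓ = ℓ []
  tabulateT (suc k) ℓ = tabulate λ a → tabulateT k (ℓ ∘ (a ∷_))

  lookupT-tabulateT : ∀ {X} k (ℓ : Word (suc d) → X) w → length w ≡ k → lookupT (tabulateT k ℓ) w ≡ ℓ w
  lookupT-tabulateT zero    ℓ []      _  = refl
  lookupT-tabulateT (suc k) ℓ (a ∷ w) eq =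
    trans (cong (λ t → lookupT {k} t w) (lookup∘tabulate (λ b → tabulateT k (ℓ ∘ (b ∷_))) a))
          (lookupT-tabulateT k (ℓ ∘ (a ∷_)) w (suc-injective eq))

  Table-searchable : ∀ {X} → Searchable X → ∀ k → Searchable (Table k X)
  Table-searchable search zero    = search
  Table-searchable search (suc k) = Vec-searchable (Table-searchable search k) (suc d)

module Labellings (H : Graph) (d : ℕ) where

  Δ : ℕ
  Δ = suc d

  Vertex : Set
  Vertex = Fin (n H)

  Labelling : Set
  Labelling = Word Δ → Vertex

  adj-sym : ∀ {x y} → adj H x y ≡ true → adj H y x ≡ true
  adj-sym {x} {y} xy = trans (Graph.sym H y x) xy

  HasNeighbour : Vertex → Set
  HasNeighbour x = ∃ λ y → adj H x y ≡ true

  -- On an isolated vertex this returns the vertex itself.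
  someNeighbour : Vertex → Vertex
  someNeighbour x with any? (λ y → adj H x y Bool.≟ true)
  ... | yes (y , _) = y
  ... | no  _       = x

  someNeighbour-adjacent : ∀ {x} → HasNeighbour x → adj H x (someNeighbour x) ≡ true
  someNeighbour-adjacent {x} neighbour with any? (λ y → adj H x y Bool.≟ true)
  ... | yes (_ , xy) = xy
  ... | no  none     = ⊥-elim (none neighbour)

  towards : Vertex → Vertex → Vertex
  towards x y = if adj H x y then y else someNeighbour x

  towards-adjacent : ∀ {x} y → HasNeighbour x → adj H x (towards x y) ≡ true
  towards-adjacent {x} y neighbour with adj H x y in xy
  ... | true  = xy
  ... | false = someNeighbour-adjacent neighbour

  towards-id : ∀ {x y} → adj H x y ≡ true → towards x y ≡ y
  towards-id xy rewrite xy = refl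

  Homomorphic : Labelling → Set
  Homomorphic ℓ = ∀ a w → adj H (ℓ w) (ℓ (a ∷ w)) ≡ true

  homomorphic⇒IsHom : ∀ {ℓ} R → Homomorphic ℓ → IsHom H Δ R ℓ
  homomorphic⇒IsHom R hom []      a _ _ = hom a []
  homomorphic⇒IsHom R hom (b ∷ w) a _ _ with b ≟ a
  ... | yes refl = adj-sym (hom b w)
  ... | no  _    = hom a (b ∷ w)

  homify : Labelling → Labelling
  homify ℓ []      = ℓ []
  homify ℓ (a ∷ w) = towards (homify ℓ w) (ℓ (a ∷ w))

  homify-homomorphic : ∀ ℓ → HasNeighbour (ℓ []) → Homomorphic (homify ℓ)
  homify-homomorphic ℓ root a w = towards-adjacent _ (neighbour w)
    where
    neighbour : ∀ w → HasNeighbour (homify ℓ w)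
    neighbour []      = root
    neighbour (a ∷ w) = homify ℓ w , adj-sym (towards-adjacent _ (neighbour w))

  homify-agree : ∀ {k ℓ ℓ′} → Homomorphic ℓ′ → AgreeUpTo k ℓ ℓ′ → AgreeUpTo k (homify ℓ) ℓ′
  homify-agree hom same []      w-in = same [] w-in
  homify-agree {ℓ = ℓ} {ℓ′} hom same (a ∷ w) w-in = begin
    towards (homify ℓ w) (ℓ (a ∷ w))  ≡⟨ cong₂ towards (homify-agree hom same w (<⇒≤ w-in)) (same (a ∷ w) w-in) ⟩
    towards (ℓ′ w) (ℓ′ (a ∷ w))       ≡⟨ towards-id (hom a w) ⟩
    ℓ′ (a ∷ w)                        ∎
    where open ≡-Reasoning

  star-homomorphic : ∀ {x t} → (∀ c → Homomorphic (t c)) → (∀ c → adj H x (t c []) ≡ true) →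
    Homomorphic (star x t)
  star-homomorphic         hom root a w with initLast w
  star-homomorphic         hom root a _ | []      = root a
  star-homomorphic {x} {t} hom root a _ | u ∷ʳ′ c =
    subst₂ (λ p q → adj H p q ≡ true) (sym (star-∷ʳ x t u c)) (sym (star-∷ʳ x t (a ∷ u) c)) (hom c a u)

  record LegalPosition (α β : Labelling) : Set where
    field
      homomorphicˡ : Homomorphic α
      homomorphicʳ : Homomorphic β
      roots        : adj H (α []) (β []) ≡ true

  open LegalPosition

  graft-homomorphic : ∀ i {α β} → LegalPosition α β → Homomorphic (graft i α β)
  graft-homomorphic i {α} {β} legal = star-homomorphic (proj₁ ∘ hangs) (proj₂ ∘ hangs)
    where
    HangsBelowRoot : Labelling → Set
    HangsBelowRoot t = Homomorphic t × adj H (α []) (t []) ≡ true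
    hangs : ∀ c → HangsBelowRoot (updateAt (λ c → branch c α) i (const β) c)
    hangs c with c ≟ i
    ... | yes refl = subst HangsBelowRoot (sym (updateAt-updates i (λ c → branch c α)))
                       (homomorphicʳ legal , roots legal)
    ... | no  c≢i  = subst HangsBelowRoot (sym (updateAt-minimal c i (λ c → branch c α) c≢i))
                       ((λ a w → homomorphicˡ legal a (w ∷ʳ c)) , homomorphicˡ legal c [])

  overwrite : ℕ → Labelling → Labelling → Labelling
  overwrite k f ℓ []      = ℓ []
  overwrite k f ℓ (a ∷ w) with length w ≟ℕ k
  ... | yes _ = f (a ∷ w)
  ... | no  _ = ℓ (a ∷ w)

  overwrite-below : ∀ k f ℓ → AgreeUpTo k (overwrite k f ℓ) ℓ
  overwrite-below k f ℓ []      _    = refl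
  overwrite-below k f ℓ (a ∷ w) w-in with length w ≟ℕ k
  ... | yes refl = ⊥-elim (1+n≰n w-in)
  ... | no  _    = refl

  overwrite-agree : ∀ {k f ℓ Λ} → AgreeUpTo k ℓ Λ → (∀ w → length w ≡ suc k → f w ≡ Λ w) →
    AgreeUpTo (suc k) (overwrite k f ℓ) Λ
  overwrite-agree     same new []      _    = same [] z≤n
  overwrite-agree {k} same new (a ∷ w) w-in with length w ≟ℕ k
  ... | yes eq = new (a ∷ w) (cong suc eq)
  ... | no  ne = same (a ∷ w) (≤∧≢⇒< (≤-pred w-in) ne)

  Move : ℕ → Set
  Move k = Table {d} (suc k) Vertex

  Move-searchable : ∀ k → Searchable (Move k)
  Move-searchable k = Table-searchable any? (suc k)

  -- Round k writes the labels at depth suc k.  Homifying keeps every board a homomorphism,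
  -- so a graft of two boards is a valid input of the algorithm from either root.
  extend : ∀ k → Move k → Labelling → Labelling
  extend k t ℓ = homify (overwrite k (lookupT t) ℓ)

  extend-below : ∀ k t {ℓ} → Homomorphic ℓ → AgreeUpTo k (extend k t ℓ) ℓ
  extend-below k t hom = homify-agree hom (overwrite-below k _ _)

  extend-tabulate : ∀ k {ℓ Λ} → Homomorphic Λ → AgreeUpTo k ℓ Λ →
    AgreeUpTo (suc k) (extend k (tabulateT (suc k) Λ) ℓ) Λ
  extend-tabulate k {Λ = Λ} hom same = homify-agree hom (overwrite-agree same (lookupT-tabulateT (suc k) Λ))

  homify-legal : ∀ {α β} → adj H (α []) (β []) ≡ true → LegalPosition (homify α) (homify β)
  homify-legal αβ = record
    { homomorphicˡ = homify-homomorphic _ (_ , αβ)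
    ; homomorphicʳ = homify-homomorphic _ (_ , adj-sym αβ)
    ; roots        = αβ
    }

  extend-legal : ∀ k s t {α β} → LegalPosition α β → LegalPosition (extend k s α) (extend k t β)
  extend-legal k s t legal = homify-legal (roots legal)

  initial : Vertex → Labelling
  initial x = homify (const x)

  open FiniteGame extend public

  rounds : ℕ → ℕ → List ℕ
  rounds k zero    = []
  rounds k (suc j) = k ∷ rounds (suc k) j

  star-legal : ∀ {k x} {α β : Fin Δ → Labelling} → (∀ i → LegalPosition (α i) (β i)) →
    (∀ i → AgreeUpTo k (α i) (star x β)) → Homomorphic (star x β)
  star-legal {x = x} {α} {β} legal same = star-homomorphic (homomorphicʳ ∘ legal)
    (λ i → subst (λ z → adj H z (β i []) ≡ true) (same i [] z≤n) (roots (legal i)))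

  -- In every game i Alice copies the star of Bob's boards, so that star agrees with all
  -- Δ games at once.
  bob-vs-alices : ∀ {P : Fin Δ → Payoff} k j x {α β : Fin Δ → Labelling} →
    (∀ i → BobWins (P i) (rounds k j) (α i) (β i)) → (∀ i → LegalPosition (α i) (β i)) →
    (∀ i → AgreeUpTo k (α i) (star x β)) →
    ∃₂ λ (α′ β′ : Fin Δ → Labelling) → (∀ i → P i (α′ i) (β′ i)) ×
      (∀ i → LegalPosition (α′ i) (β′ i)) × (∀ i → AgreeUpTo (j + k) (α′ i) (star x β′))
  bob-vs-alices k zero    x wins legal same = _ , _ , wins , legal , same
  bob-vs-alices k (suc j) x {α} {β} wins legal same =
    let α′ , β′ , won , legal′ , same′ = bob-vs-alices (suc k) j x (proj₂ ∘ reply) (λ i → extend-legal k _ _ (legal i)) same-next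
    in α′ , β′ , won , legal′ , λ i → subst (λ K → AgreeUpTo K (α′ i) (star x β′)) (+-suc j k) (same′ i)
    where
    copy : Move k
    copy = tabulateT (suc k) (star x β)
    reply : ∀ i → ∃ λ g → BobWins _ (rounds (suc k) j) (extend k copy (α i)) (extend k g (β i))
    reply i = wins i copy
    same-next : ∀ i → AgreeUpTo (suc k) (extend k copy (α i)) (star x (λ c → extend k (proj₁ (reply c)) (β c)))
    same-next i w w-in =
      trans (extend-tabulate k (star-legal legal same) (same i) w w-in)
            (star-agree (λ c v v-in → sym (extend-below k _ (homomorphicʳ (legal c)) v v-in)) w w-in)

  module FromAlgorithm (A : RTree Vertex → Maybe (Fin Δ)) (r : ℕ) (colours : DeltaColorsHom H Δ r (suc r) A) where

    R : ℕ
    R = suc r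

    root : VertexOf {Δ} R []
    root = tt , z≤n

    child : ∀ i → VertexOf {Δ} R (i ∷ [])
    child i = tt , s≤s z≤n

    ColoursRoot : Fin Δ → Payoff
    ColoursRoot i α β = A (ball R (graft i α β) r [] nothing) ≡ just i

    coloursRoot? : ∀ i α β → Dec (ColoursRoot i α β)
    coloursRoot? i α β = ≡-dec _≟_ _ _

    Forces : Vertex → Fin Δ → Set
    Forces x i = ∀ y → adj H x y ≡ true → AliceWins (ColoursRoot i) (rounds 0 r) (initial x) (initial y)

    Blocks : Vertex → Fin Δ → Set
    Blocks x i = ∃ λ y → adj H x y ≡ true ×
      BobWins (λ α β → ¬ ColoursRoot i α β) (rounds 0 r) (initial x) (initial y)

    wins? : ∀ i x y → Dec (AliceWins (ColoursRoot i) (rounds 0 r) (initial x) (initial y))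
    wins? i x y = aliceWins? Move-searchable (coloursRoot? i) (rounds 0 r) (initial x) (initial y)

    forces? : ∀ x i → Dec (Forces x i)
    forces? x i = all? λ y → (adj H x y Bool.≟ true) →-dec wins? i x y

    blocks-unless-forces : ∀ x i → ¬ Forces x i → Blocks x i
    blocks-unless-forces x i ¬forces
      with any? (λ y → (adj H x y Bool.≟ true) ×-dec ¬? (wins? i x y))
    ... | yes (y , xy , ¬won) = y , xy , determinacy Move-searchable (coloursRoot? i) (rounds 0 r) _ _ ¬won
    ... | no  none            = ⊥-elim (¬forces λ y xy →
      decidable-stable (wins? i x y) (λ ¬won → none (y , xy , ¬won)))

    forced-colours-differ : ∀ {x y i} → adj H x y ≡ true → Forces x i → Forces y i → ⊥
    forced-colours-differ {x} {y} {i} xy x-forces y-forces =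
      let α , β , legal , at-root , at-child =
            alice-vs-alice LegalPosition extend-legal (rounds 0 r) (homify-legal xy) (x-forces y xy) (y-forces x (adj-sym xy))
          colour , colour-spec , proper = colours (graft i α β) (homomorphic⇒IsHom R (graft-homomorphic i legal))
          open ≡-Reasoning
      in proper [] i root (child i) (just-injective (begin
        just (colour [] root)                         ≡⟨ colour-spec [] root ⟨
        A (ball R (graft i α β) r [] nothing)         ≡⟨ at-root ⟩
        just i                                        ≡⟨ at-child ⟨
        A (ball R (graft i β α) r [] nothing)         ≡⟨ cong A (ball-transport (translate i) (step-translate i) R r [] nothing tt
                                                                  (n≤1+n r) ≤-refl (λ w red _ → graft-translate i α β w red)) ⟨
        A (ball R (graft i α β) r (i ∷ []) nothing)   ≡⟨ colour-spec (i ∷ []) (child i) ⟩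
        just (colour (i ∷ []) (child i))              ∎))

    not-all-blocked : ∀ x → (∀ i → Blocks x i) → ⊥
    not-all-blocked x blocks =
      let α , β , ¬won , legal , same =
            bob-vs-alices 0 r x (proj₂ ∘ proj₂ ∘ blocks) (homify-legal ∘ proj₁ ∘ proj₂ ∘ blocks) (λ { _ [] _ → refl })
          colour , colour-spec , _ = colours (star x β) (homomorphic⇒IsHom R (star-legal legal same))
          c = colour [] root
      in ¬won c (trans (cong A (ball-transport id (λ _ _ → refl) R r [] nothing tt (n≤1+n r) (n≤1+n r)
                         (λ w _ w-in → graft-agree (same c) (λ v → sym (star-∷ʳ x β v c)) w (≤-trans w-in (m≤m+n r 0)))))
                       (colour-spec [] root))

    some-colour-forced : ∀ x → ∃ (Forces x)
    some-colour-forced x with any? (forces? x)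
    ... | yes forced = forced
    ... | no  none   = ⊥-elim (not-all-blocked x λ i → blocks-unless-forces x i (none ∘ (i ,_)))

    colorable : ProperlyColorable H Δ
    colorable = proj₁ ∘ some-colour-forced , λ x y xy same →
      forced-colours-differ xy (proj₂ (some-colour-forced x)) (subst (Forces y) (sym same) (proj₂ (some-colour-forced y)))

rootLabel : ∀ {L} → RTree L → L
rootLabel (node x _) = x

colorable⇒glocal₀ : ∀ H Δ → ProperlyColorable H Δ → ∀ r → GlocalColorable H Δ 0 r
colorable⇒glocal₀ H Δ (colour , proper) r =
  (λ t → just (colour (rootLabel t))) ,
  (λ { (node _ _) (node _ _) (node refl _) → refl }) ,
  (λ ℓ hom → (λ v _ → colour (ℓ v)) , (λ _ _ → refl) , λ v a p q → proper _ _ (hom v a p q))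

glocal₀⇒glocal : ∀ H Δ → (∀ r → GlocalColorable H Δ 0 r) → Σ ℕ (λ r → GlocalColorable H Δ r (suc r))
glocal₀⇒glocal H Δ glocal = 0 , glocal 1

glocal⇒colorable : ∀ H d → Σ ℕ (λ r → GlocalColorable H (suc d) r (suc r)) → ProperlyColorable H (suc d)
glocal⇒colorable H d (r , A , _ , colours) = Labellings.FromAlgorithm.colorable H d A r colours

mainTheorem4 : (H : Graph) (Δ : ℕ) → 1 ≤ Δ →
    (ProperlyColorable H Δ ⇔ (∀ r → GlocalColorable H Δ 0 r))
    × (ProperlyColorable H Δ ⇔ Σ ℕ (λ r → GlocalColorable H Δ r (suc r)))
mainTheorem4 H (suc d) _ =
  mk⇔ (colorable⇒glocal₀ H (suc d)) (glocal⇒colorable H d ∘ glocal₀⇒glocal H (suc d)) ,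
  mk⇔ (glocal₀⇒glocal H (suc d) ∘ colorable⇒glocal₀ H (suc d)) (glocal⇒colorable H d)
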